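{- Let $j\ge 2$ and let $G$ be a $j$-erasable graph on $n$ vertices. Then $G$ does not contain a $(j+2)$-connected subgraph.
   Context: Let $j\ge 2$. For a graph $G$ with at least $j+1$ vertices, the $j$-erase procedure deletes an edge $e\in E(G)$ provided there exist two disjoint sets $V^1,V^2\subset V(G)$ such that $e$ is the only edge of $G$ between $V^1$ and $V^2$ and $|V(G)|-|V^1|-|V^2|=j$; by convention, the $j$-erase procedure may also be applied to any edge of any graph on $j+1$ vertices. A graph is $j$-erasable if the $j$-erase procedure can be applied repeatedly until the graph has no edges. -}

module Defs where

open import Data.Nat using (ℕ; suc; _+_; _<_; _≤_)
open import Data.Bool using (Bool; true; false; _∧_; not)
open import Data.Fin using (Fin)
open import Data.Fin.Properties using (_≟_)
open import Data.Fin.Subset using (Subset; _∈_; _∉_; _⊆_; _─_; ∣_∣)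
open import Data.Product using (_×_; Σ; ∃; ∃-syntax; _,_)
open import Data.Sum using (_⊎_)
open import Relation.Nullary using (¬_)
open import Relation.Nullary.Decidable using (⌊_⌋)
open import Relation.Binary.PropositionalEquality using (_≡_)
open import Relation.Binary.Construct.Closure.ReflexiveTransitive using (Star)

Adj : ℕ → Set
Adj n = Fin n → Fin n → Bool

record SimpleGraph {n : ℕ} (G : Adj n) : Set where
  field
    sym     : ∀ x y → G x y ≡ G y x
    irrefl  : ∀ x → G x x ≡ false

removeEdge : {n : ℕ} → Adj n → Fin n → Fin n → Adj n
removeEdge G u v x y =
  G x y ∧ not ((⌊ x ≟ u ⌋ ∧ ⌊ y ≟ v ⌋) Data.Bool.∨ (⌊ x ≟ v ⌋ ∧ ⌊ y ≟ u ⌋))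

SameEdge : {n : ℕ} → Fin n → Fin n → Fin n → Fin n → Set
SameEdge x y u v = (x ≡ u × y ≡ v) ⊎ (x ≡ v × y ≡ u)

OnlyEdgeBetween : {n : ℕ} → Adj n → Fin n → Fin n → Subset n → Subset n → Set
OnlyEdgeBetween G u v V1 V2 =
  ((u ∈ V1 × v ∈ V2) ⊎ (v ∈ V1 × u ∈ V2)) ×
  (∀ x y → x ∈ V1 → y ∈ V2 → G x y ≡ true → SameEdge x y u v)

data EraseStep (j : ℕ) {n : ℕ} : Adj n → Adj n → Set where
  erase-cut : (G : Adj n) (u v : Fin n) → G u v ≡ true → suc j ≤ n →
              (V1 V2 : Subset n) →
              (∀ x → x ∈ V1 → x ∉ V2) →
              OnlyEdgeBetween G u v V1 V2 →
              n ≡ ∣ V1 ∣ + ∣ V2 ∣ + j →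
              EraseStep j G (removeEdge G u v)
  erase-small : (G : Adj n) (u v : Fin n) → G u v ≡ true → n ≡ suc j →
              EraseStep j G (removeEdge G u v)

Edgeless : {n : ℕ} → Adj n → Set
Edgeless G = ∀ x y → G x y ≡ false

Erasable : (j : ℕ) {n : ℕ} → Adj n → Set
Erasable j G = ∃[ G' ] (Star (EraseStep j) G G' × Edgeless G')

data Reach {n : ℕ} (H : Adj n) (W : Subset n) : Fin n → Fin n → Set where
  here  : ∀ {x} → x ∈ W → Reach H W x x
  there : ∀ {x y z} → x ∈ W → H x y ≡ true → Reach H W y z → Reach H W x z

ConnectedOn : {n : ℕ} → Adj n → Subset n → Set
ConnectedOn H W = ∀ x y → x ∈ W → y ∈ W → Reach H W x y

KConnected : ℕ → {n : ℕ} → Adj n → Subset n → Set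
KConnected k H S =
  k < ∣ S ∣ × (∀ X → X ⊆ S → ∣ X ∣ < k → ConnectedOn H (S ─ X))

IsSubgraph : {n : ℕ} → Adj n → Subset n → Adj n → Set
IsSubgraph G S H = ∀ x y → x ∈ S → y ∈ S → H x y ≡ true → G x y ≡ true

HasKConnectedSubgraph : ℕ → {n : ℕ} → Adj n → Set
HasKConnectedSubgraph k G =
  Σ (Subset _) λ S → Σ (Adj _) λ H → SimpleGraph H × IsSubgraph G S H × KConnected k H S

{-# OPTIONS --safe #-}
-- Let (S, H) be a (j+2)-connected subgraph of G; we show that no j-erase step deletes an edge of
-- H inside S, so the process cannot end with an edgeless graph. A step on j+1 vertices is
-- impossible, as S alone has more than j+2 vertices. Suppose a step deletes the only edge uv
-- between V1 and V2 with u, v ∈ S, and let C be the at most j vertices of S outside V1 ∪ V2.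
-- Since |S| > j + 2 there is a vertex w ∈ S \ (C ∪ {u, v}); then C together with the endpoint
-- of uv on w's side separates w from the other endpoint, so j + 2 ≤ |C| + 1 ≤ j + 1.
module Submission where

open import Defs
open import Data.Nat using (ℕ; suc; _+_; _∸_; _≤_; _<_; _≰_; z≤n; s≤s; s≤s⁻¹)
open import Data.Nat.Properties
  using (≤-trans; ≤-reflexive; ≤-<-trans; <-≤-trans; <⇒≤; ≮⇒≥; _<?_; <⇒≱; 1+n≰n;
         +-comm; +-suc; +-identityʳ; m≤m+n; m+n∸m≡n; module ≤-Reasoning)
open import Data.Bool using (true; false; _∧_; _∨_; not)
open import Data.Bool.Properties using (∧-identityʳ)
open import Data.Fin using (Fin)
open import Data.Fin.Properties using (_≟_; any?)
open import Data.Fin.Subset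
  using (Subset; _∈_; _∉_; _⊆_; _─_; _∪_; _∩_; ⁅_⁆; ⊥; ∣_∣; Empty; inside; outside)
open import Data.Fin.Subset.Properties
  using (_∈?_; x∈p∪q⁺; x∈p∪q⁻; x∈p∩q⁻; x∈⁅x⁆; x∈⁅y⁆⇒x≡y; x≢y⇒x∉⁅y⁆; x∉⁅y⁆⇒x≢y; ∉⊥; ⊥⊆;
         x∈p∧x∉q⇒x∈p─q; p─q⊆p; p─⊥≡p; x∉p⇒x∈∁p; Empty-unique;
         ∣⁅x⁆∣≡1; ∣⊥∣≡0; ∣p∣≤n; ∣∁p∣≡n∸∣p∣; p⊆q⇒∣p∣≤∣q∣)
open import Data.Vec using (_∷_; []; here; there)
open import Data.Product using (_×_; _,_; proj₁; ∃; ∃₂; uncurry)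
open import Data.Sum using (_⊎_; inj₁; inj₂; [_,_])
open import Function using (_∘_; id)
open import Relation.Nullary using (¬_; Dec; yes; no; contradiction; ¬?)
open import Relation.Nullary.Decidable using (⌊_⌋; _×-dec_; decidable-stable)
open import Relation.Binary.PropositionalEquality
  using (_≡_; _≢_; refl; sym; trans; cong; cong₂; subst; module ≡-Reasoning)
open import Relation.Binary.Construct.Closure.ReflexiveTransitive using (Star; ε; _◅_)

variable
  n k : ℕ

Disjoint : Subset n → Subset n → Set
Disjoint p q = ∀ x → x ∈ p → x ∉ q

x∈p─q⇒x∉q : ∀ {x : Fin n} (p q : Subset n) → x ∈ p ─ q → x ∉ q
x∈p─q⇒x∉q (_ ∷ p) (outside ∷ q) here      ()
x∈p─q⇒x∉q (_ ∷ p) (_       ∷ q) (there m) (there m′) = x∈p─q⇒x∉q p q m m′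

x∈p∧x∉p─q⇒x∈q : ∀ {x : Fin n} {p q : Subset n} → x ∈ p → x ∉ p ─ q → x ∈ q
x∈p∧x∉p─q⇒x∈q {x = x} {q = q} x∈p x∉p─q =
  decidable-stable (x ∈? q) (x∉p─q ∘ x∈p∧x∉q⇒x∈p─q x∈p)

∃∈∉ : ∀ {p q : Subset n} → ∣ q ∣ < ∣ p ∣ → ∃ λ x → x ∈ p × x ∉ q
∃∈∉ {p = p} {q} ∣q∣<∣p∣ with any? (λ x → x ∈? p ×-dec ¬? (x ∈? q))
... | yes (x , x∈p , x∉q) = x , x∈p , x∉q
... | no ∄ = contradiction (p⊆q⇒∣p∣≤∣q∣ p⊆q) (<⇒≱ ∣q∣<∣p∣)
  where
  p⊆q : p ⊆ q
  p⊆q {x} x∈p = decidable-stable (x ∈? q) (λ x∉q → ∄ (x , x∈p , x∉q))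

∣p∪q∣+∣p∩q∣≡∣p∣+∣q∣ : ∀ (p q : Subset n) → ∣ p ∪ q ∣ + ∣ p ∩ q ∣ ≡ ∣ p ∣ + ∣ q ∣
∣p∪q∣+∣p∩q∣≡∣p∣+∣q∣ []            []            = refl
∣p∪q∣+∣p∩q∣≡∣p∣+∣q∣ (outside ∷ p) (outside ∷ q) = ∣p∪q∣+∣p∩q∣≡∣p∣+∣q∣ p q
∣p∪q∣+∣p∩q∣≡∣p∣+∣q∣ (inside  ∷ p) (outside ∷ q) = cong suc (∣p∪q∣+∣p∩q∣≡∣p∣+∣q∣ p q)
∣p∪q∣+∣p∩q∣≡∣p∣+∣q∣ (outside ∷ p) (inside  ∷ q) =
  trans (cong suc (∣p∪q∣+∣p∩q∣≡∣p∣+∣q∣ p q)) (sym (+-suc ∣ p ∣ ∣ q ∣))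
∣p∪q∣+∣p∩q∣≡∣p∣+∣q∣ (inside  ∷ p) (inside  ∷ q) = cong suc (begin
  ∣ p ∪ q ∣ + suc ∣ p ∩ q ∣  ≡⟨ +-suc ∣ p ∪ q ∣ ∣ p ∩ q ∣ ⟩
  suc (∣ p ∪ q ∣ + ∣ p ∩ q ∣) ≡⟨ cong suc (∣p∪q∣+∣p∩q∣≡∣p∣+∣q∣ p q) ⟩
  suc (∣ p ∣ + ∣ q ∣)        ≡⟨ +-suc ∣ p ∣ ∣ q ∣ ⟨
  ∣ p ∣ + suc ∣ q ∣          ∎)
  where open ≡-Reasoning

∣p∪q∣≤∣p∣+∣q∣ : ∀ (p q : Subset n) → ∣ p ∪ q ∣ ≤ ∣ p ∣ + ∣ q ∣
∣p∪q∣≤∣p∣+∣q∣ p q =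
  ≤-trans (m≤m+n ∣ p ∪ q ∣ ∣ p ∩ q ∣) (≤-reflexive (∣p∪q∣+∣p∩q∣≡∣p∣+∣q∣ p q))

∣⁅x⁆∪p∣≤1+∣p∣ : ∀ (x : Fin n) (p : Subset n) → ∣ ⁅ x ⁆ ∪ p ∣ ≤ suc ∣ p ∣
∣⁅x⁆∪p∣≤1+∣p∣ x p = subst (λ m → ∣ ⁅ x ⁆ ∪ p ∣ ≤ m + ∣ p ∣) (∣⁅x⁆∣≡1 x) (∣p∪q∣≤∣p∣+∣q∣ ⁅ x ⁆ p)

Disjoint⇒∣p∪q∣≡∣p∣+∣q∣ : ∀ {p q : Subset n} → Disjoint p q → ∣ p ∪ q ∣ ≡ ∣ p ∣ + ∣ q ∣
Disjoint⇒∣p∪q∣≡∣p∣+∣q∣ {n} {p} {q} disjoint = begin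
  ∣ p ∪ q ∣               ≡⟨ +-identityʳ ∣ p ∪ q ∣ ⟨
  ∣ p ∪ q ∣ + 0           ≡⟨ cong (∣ p ∪ q ∣ +_) ∣p∩q∣≡0 ⟨
  ∣ p ∪ q ∣ + ∣ p ∩ q ∣   ≡⟨ ∣p∪q∣+∣p∩q∣≡∣p∣+∣q∣ p q ⟩
  ∣ p ∣ + ∣ q ∣           ∎
  where
  open ≡-Reasoning
  p∩q-empty : Empty (p ∩ q)
  p∩q-empty (x , x∈p∩q) = uncurry (disjoint x) (x∈p∩q⁻ p q x∈p∩q)
  ∣p∩q∣≡0 : ∣ p ∩ q ∣ ≡ 0
  ∣p∩q∣≡0 = trans (cong ∣_∣ (Empty-unique p∩q-empty)) (∣⊥∣≡0 n)

∣p─q∣≤n∸∣q∣ : ∀ (p q : Subset n) → ∣ p ─ q ∣ ≤ n ∸ ∣ q ∣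
∣p─q∣≤n∸∣q∣ p q =
  subst (∣ p ─ q ∣ ≤_) (∣∁p∣≡n∸∣p∣ q) (p⊆q⇒∣p∣≤∣q∣ (x∉p⇒x∈∁p ∘ x∈p─q⇒x∉q p q))

module _ {H : Adj n} {W : Subset n} where

  Reach-source : ∀ {a b} → Reach H W a b → a ∈ W
  Reach-source (here a∈W)      = a∈W
  Reach-source (there a∈W _ _) = a∈W

  Reach⇒edge : ∀ {a b} → Reach H W a b → a ≢ b → ∃₂ λ x y → x ∈ W × y ∈ W × H x y ≡ true
  Reach⇒edge (here _)                    a≢a = contradiction refl a≢a
  Reach⇒edge (there {y = y} a∈W ay path) _   = _ , y , a∈W , Reach-source path , ay

  Reach-crossing : ∀ {V₁ V₂ a b} → Disjoint V₁ V₂ → W ⊆ V₁ ∪ V₂ →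
                   Reach H W a b → a ∈ V₁ → b ∈ V₂ →
                   ∃₂ λ x y → x ∈ W × y ∈ W × x ∈ V₁ × y ∈ V₂ × H x y ≡ true
  Reach-crossing disjoint W⊆V₁∪V₂ (here _) a∈V₁ a∈V₂ = contradiction a∈V₂ (disjoint _ a∈V₁)
  Reach-crossing {V₁} {V₂} disjoint W⊆V₁∪V₂ (there {y = y} a∈W ay path) a∈V₁ b∈V₂
    with x∈p∪q⁻ V₁ V₂ (W⊆V₁∪V₂ (Reach-source path))
  ... | inj₁ y∈V₁ = Reach-crossing disjoint W⊆V₁∪V₂ path y∈V₁ b∈V₂
  ... | inj₂ y∈V₂ = _ , y , a∈W , Reach-source path , a∈V₁ , y∈V₂ , ay

KConnected⇒edge : ∀ {H : Adj n} {S} → KConnected (suc k) H S →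
                  ∃₂ λ x y → x ∈ S × y ∈ S × H x y ≡ true
KConnected⇒edge {n} {k} {H} {S} (∣S∣>1+k , connected)
  with ∃∈∉ {q = ⊥} (≤-<-trans (≤-reflexive (∣⊥∣≡0 n)) (≤-<-trans z≤n ∣S∣>1+k))
... | a , a∈S , _
  with ∃∈∉ {q = ⁅ a ⁆} (≤-<-trans (≤-reflexive (∣⁅x⁆∣≡1 a)) (≤-<-trans (s≤s z≤n) ∣S∣>1+k))
... | b , b∈S , b∉⁅a⁆ =
  Reach⇒edge (subst (λ W → Reach H W a b) (p─⊥≡p S) path) (x∉⁅y⁆⇒x≢y b∉⁅a⁆ ∘ sym)
  where
  path : Reach H (S ─ ⊥) a b
  path = connected ⊥ ⊥⊆ (≤-<-trans (≤-reflexive (∣⊥∣≡0 n)) (s≤s z≤n)) a b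
           (x∈p∧x∉q⇒x∈p─q a∈S ∉⊥) (x∈p∧x∉q⇒x∈p─q b∈S ∉⊥)

record Bridge (G : Adj n) (V₁ V₂ : Subset n) (p q : Fin n) : Set where
  field
    source∈ : p ∈ V₁
    target∈ : q ∈ V₂
    unique  : ∀ x y → x ∈ V₁ → y ∈ V₂ → G x y ≡ true → x ≡ p × y ≡ q

OnlyEdgeBetween⇒Bridge : ∀ {G : Adj n} {u v V₁ V₂} → Disjoint V₁ V₂ → OnlyEdgeBetween G u v V₁ V₂ →
                         Bridge G V₁ V₂ u v ⊎ Bridge G V₁ V₂ v u
OnlyEdgeBetween⇒Bridge {G = G} {u} {v} {V₁} {V₂} disjoint (inj₁ (u∈V₁ , v∈V₂) , only) =
  inj₁ record { source∈ = u∈V₁ ; target∈ = v∈V₂ ; unique = unique }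
  where
  unique : ∀ x y → x ∈ V₁ → y ∈ V₂ → G x y ≡ true → x ≡ u × y ≡ v
  unique x y x∈V₁ y∈V₂ xy with only x y x∈V₁ y∈V₂ xy
  ... | inj₁ x≡u,y≡v   = x≡u,y≡v
  ... | inj₂ (refl , _) = contradiction v∈V₂ (disjoint v x∈V₁)
OnlyEdgeBetween⇒Bridge {G = G} {u} {v} {V₁} {V₂} disjoint (inj₂ (v∈V₁ , u∈V₂) , only) =
  inj₂ record { source∈ = v∈V₁ ; target∈ = u∈V₂ ; unique = unique }
  where
  unique : ∀ x y → x ∈ V₁ → y ∈ V₂ → G x y ≡ true → x ≡ v × y ≡ u
  unique x y x∈V₁ y∈V₂ xy with only x y x∈V₁ y∈V₂ xy
  ... | inj₁ (refl , _) = contradiction u∈V₂ (disjoint u x∈V₁)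
  ... | inj₂ x≡v,y≡u   = x≡v,y≡u

KConnected⇒k≤∣separator∣ : ∀ {H : Adj n} {S X V₁ V₂ a b} → KConnected k H S → X ⊆ S →
                           Disjoint V₁ V₂ → S ─ X ⊆ V₁ ∪ V₂ →
                           (∀ x y → x ∈ S ─ X → y ∈ S ─ X → x ∈ V₁ → y ∈ V₂ → H x y ≢ true) →
                           a ∈ S ─ X → b ∈ S ─ X → a ∈ V₁ → b ∈ V₂ → k ≤ ∣ X ∣
KConnected⇒k≤∣separator∣ {X = X} (_ , connected) X⊆S disjoint S─X⊆V no-edge a∈ b∈ a∈V₁ b∈V₂ =
  ≮⇒≥ λ ∣X∣<k →
    let x , y , x∈ , y∈ , x∈V₁ , y∈V₂ , xy∈H =
          Reach-crossing disjoint S─X⊆V (connected X X⊆S ∣X∣<k _ _ a∈ b∈) a∈V₁ b∈V₂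
    in no-edge x y x∈ y∈ x∈V₁ y∈V₂ xy∈H

module _ {G H : Adj n} {S V₁ V₂ : Subset n} {p q : Fin n} (connected : KConnected k H S)
         (H⊆G : IsSubgraph G S H) (disjoint : Disjoint V₁ V₂) (bridge : Bridge G V₁ V₂ p q) where

  open Bridge bridge

  private
    p,q,C : Subset n
    p,q,C = ⁅ p ⁆ ∪ ⁅ q ⁆ ∪ (S ─ (V₁ ∪ V₂))

    p≢q : p ≢ q
    p≢q refl = disjoint p source∈ target∈

  -- Removing the vertices of S outside V₁ ∪ V₂ and one endpoint r of the bridge separates V₁ from V₂.
  Bridge-endpoint-separator : ∀ {r a b} → r ∈ S → r ≡ p ⊎ r ≡ q →
                              a ∈ S → a ∈ V₁ → a ≢ r → b ∈ S → b ∈ V₂ → b ≢ r →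
                              k ≤ suc ∣ S ─ (V₁ ∪ V₂) ∣
  Bridge-endpoint-separator {r} r∈S r∈pq a∈S a∈V₁ a≢r b∈S b∈V₂ b≢r =
    ≤-trans (KConnected⇒k≤∣separator∣ connected X⊆S disjoint S─X⊆V no-edge
               (∈S─X a∈S (x∈p∪q⁺ (inj₁ a∈V₁)) a≢r) (∈S─X b∈S (x∈p∪q⁺ (inj₂ b∈V₂)) b≢r) a∈V₁ b∈V₂)
            (∣⁅x⁆∪p∣≤1+∣p∣ r C)
    where
    C X : Subset _
    C = S ─ (V₁ ∪ V₂)
    X = ⁅ r ⁆ ∪ C

    X⊆S : X ⊆ S
    X⊆S x∈X = [ (λ x∈⁅r⁆ → subst (_∈ S) (sym (x∈⁅y⁆⇒x≡y r x∈⁅r⁆)) r∈S) , p─q⊆p S _ ]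
                (x∈p∪q⁻ ⁅ r ⁆ C x∈X)

    S─X⊆V : S ─ X ⊆ V₁ ∪ V₂
    S─X⊆V x∈ = x∈p∧x∉p─q⇒x∈q (p─q⊆p S X x∈) (x∈p─q⇒x∉q S X x∈ ∘ x∈p∪q⁺ ∘ inj₂)

    ∈S─X : ∀ {x} → x ∈ S → x ∈ V₁ ∪ V₂ → x ≢ r → x ∈ S ─ X
    ∈S─X x∈S x∈V x≢r =
      x∈p∧x∉q⇒x∈p─q x∈S ([ x≢y⇒x∉⁅y⁆ x≢r , (λ x∈C → x∈p─q⇒x∉q S (V₁ ∪ V₂) x∈C x∈V) ]
                          ∘ x∈p∪q⁻ ⁅ r ⁆ C)

    r∉S─X : r ∉ S ─ X
    r∉S─X r∈ = x∈p─q⇒x∉q S X r∈ (x∈p∪q⁺ (inj₁ (x∈⁅x⁆ r)))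

    no-edge : ∀ x y → x ∈ S ─ X → y ∈ S ─ X → x ∈ V₁ → y ∈ V₂ → H x y ≢ true
    no-edge x y x∈ y∈ x∈V₁ y∈V₂ xy∈H
      with unique x y x∈V₁ y∈V₂ (H⊆G x y (p─q⊆p S X x∈) (p─q⊆p S X y∈) xy∈H)
    ... | refl , refl = [ (λ { refl → r∉S─X x∈ }) , (λ { refl → r∉S─X y∈ }) ] r∈pq

  -- Either S ⊆ {p, q} ∪ C, or a vertex w ∈ S outside it is separated from the far endpoint.
  Bridge-separator : p ∈ S → q ∈ S → k ≤ suc ∣ S ─ (V₁ ∪ V₂) ∣
  Bridge-separator p∈S q∈S with ∣ p,q,C ∣ <? ∣ S ∣
  ... | no ∣p,q,C∣≮∣S∣ =
    s≤s⁻¹ (<-≤-trans (proj₁ connected) (≤-trans (≮⇒≥ ∣p,q,C∣≮∣S∣) ∣p,q,C∣≤2+∣C∣))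
    where
    ∣p,q,C∣≤2+∣C∣ : ∣ p,q,C ∣ ≤ 2 + ∣ S ─ (V₁ ∪ V₂) ∣
    ∣p,q,C∣≤2+∣C∣ = ≤-trans (∣⁅x⁆∪p∣≤1+∣p∣ p _) (s≤s (∣⁅x⁆∪p∣≤1+∣p∣ q _))
  ... | yes ∣p,q,C∣<∣S∣ with ∃∈∉ ∣p,q,C∣<∣S∣
  ... | w , w∈S , w∉p,q,C
    with x∈p∪q⁻ V₁ V₂ (x∈p∧x∉p─q⇒x∈q w∈S (w∉p,q,C ∘ x∈p∪q⁺ ∘ inj₂ ∘ x∈p∪q⁺ ∘ inj₂))
  ... | inj₁ w∈V₁ = Bridge-endpoint-separator p∈S (inj₁ refl) w∈S w∈V₁ w≢p q∈S target∈ (p≢q ∘ sym)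
    where
    w≢p : w ≢ p
    w≢p = x∉⁅y⁆⇒x≢y (w∉p,q,C ∘ x∈p∪q⁺ ∘ inj₁)
  ... | inj₂ w∈V₂ = Bridge-endpoint-separator q∈S (inj₂ refl) p∈S source∈ p≢q w∈S w∈V₂ w≢q
    where
    w≢q : w ≢ q
    w≢q = x∉⁅y⁆⇒x≢y (w∉p,q,C ∘ x∈p∪q⁺ ∘ inj₂ ∘ x∈p∪q⁺ ∘ inj₁)

⌊⌋∧⌊⌋≡false : ∀ {A B : Set} (a? : Dec A) (b? : Dec B) → ¬ (A × B) → ⌊ a? ⌋ ∧ ⌊ b? ⌋ ≡ false
⌊⌋∧⌊⌋≡false (yes a) (yes b) ¬a×b = contradiction (a , b) ¬a×b
⌊⌋∧⌊⌋≡false (yes _) (no _)  _    = refl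
⌊⌋∧⌊⌋≡false (no _)  _       _    = refl

removeEdge-other : ∀ (G : Adj n) {u v x y} → ¬ SameEdge x y u v → removeEdge G u v x y ≡ G x y
removeEdge-other G {u} {v} {x} {y} ¬same = begin
  G x y ∧ not ((⌊ x ≟ u ⌋ ∧ ⌊ y ≟ v ⌋) ∨ (⌊ x ≟ v ⌋ ∧ ⌊ y ≟ u ⌋))
    ≡⟨ cong (λ b → G x y ∧ not b) (cong₂ _∨_ (⌊⌋∧⌊⌋≡false (x ≟ u) (y ≟ v) (¬same ∘ inj₁))
                                             (⌊⌋∧⌊⌋≡false (x ≟ v) (y ≟ u) (¬same ∘ inj₂))) ⟩
  G x y ∧ true
    ≡⟨ ∧-identityʳ (G x y) ⟩
  G x y ∎
  where open ≡-Reasoning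

removeEdge-keeps-subgraph : ∀ {G H : Adj n} {S u v} → ¬ (u ∈ S × v ∈ S) →
                            IsSubgraph G S H → IsSubgraph (removeEdge G u v) S H
removeEdge-keeps-subgraph {G = G} {S = S} ¬u,v∈S H⊆G x y x∈S y∈S xy∈H =
  trans (removeEdge-other G (¬u,v∈S ∘ endpoints)) (H⊆G x y x∈S y∈S xy∈H)
  where
  endpoints : ∀ {u v} → SameEdge x y u v → u ∈ S × v ∈ S
  endpoints (inj₁ (refl , refl)) = x∈S , y∈S
  endpoints (inj₂ (refl , refl)) = y∈S , x∈S

∣S─V₁∪V₂∣≤j : ∀ {j} {S V₁ V₂ : Subset n} → Disjoint V₁ V₂ → n ≡ ∣ V₁ ∣ + ∣ V₂ ∣ + j →
              ∣ S ─ (V₁ ∪ V₂) ∣ ≤ j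
∣S─V₁∪V₂∣≤j {n} {j} {S} {V₁} {V₂} disjoint n≡ = begin
  ∣ S ─ (V₁ ∪ V₂) ∣                       ≤⟨ ∣p─q∣≤n∸∣q∣ S (V₁ ∪ V₂) ⟩
  n ∸ ∣ V₁ ∪ V₂ ∣                         ≡⟨ cong (n ∸_) (Disjoint⇒∣p∪q∣≡∣p∣+∣q∣ disjoint) ⟩
  n ∸ (∣ V₁ ∣ + ∣ V₂ ∣)                   ≡⟨ cong (_∸ (∣ V₁ ∣ + ∣ V₂ ∣)) n≡ ⟩
  ∣ V₁ ∣ + ∣ V₂ ∣ + j ∸ (∣ V₁ ∣ + ∣ V₂ ∣) ≡⟨ m+n∸m≡n (∣ V₁ ∣ + ∣ V₂ ∣) j ⟩
  j                                       ∎
  where open ≤-Reasoning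

j+2≰1+j : ∀ j → j + 2 ≰ suc j
j+2≰1+j j j+2≤1+j = 1+n≰n (subst (_≤ suc j) (+-comm j 2) j+2≤1+j)

module _ {j} {H : Adj n} {S} (connected : KConnected (j + 2) H S) where

  EraseStep-keeps-subgraph : ∀ {G G′} → EraseStep j G G′ → IsSubgraph G S H → IsSubgraph G′ S H
  EraseStep-keeps-subgraph (erase-small _ _ _ _ n≡1+j) _ =
    contradiction (subst (j + 2 ≤_) n≡1+j (<⇒≤ (<-≤-trans (proj₁ connected) (∣p∣≤n S)))) (j+2≰1+j j)
  EraseStep-keeps-subgraph (erase-cut _ u v _ _ V₁ V₂ disjoint only n≡) H⊆G
    with u ∈? S ×-dec v ∈? S
  ... | no ¬u,v∈S = removeEdge-keeps-subgraph ¬u,v∈S H⊆G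
  ... | yes (u∈S , v∈S) =
    contradiction (≤-trans separator (s≤s (∣S─V₁∪V₂∣≤j {S = S} disjoint n≡))) (j+2≰1+j j)
    where
    separator : j + 2 ≤ suc ∣ S ─ (V₁ ∪ V₂) ∣
    separator with OnlyEdgeBetween⇒Bridge disjoint only
    ... | inj₁ bridge = Bridge-separator connected H⊆G disjoint bridge u∈S v∈S
    ... | inj₂ bridge = Bridge-separator connected H⊆G disjoint bridge v∈S u∈S

  Erasing-keeps-subgraph : ∀ {G G′} → Star (EraseStep j) G G′ → IsSubgraph G S H → IsSubgraph G′ S H
  Erasing-keeps-subgraph ε              = id
  Erasing-keeps-subgraph (step ◅ steps) = Erasing-keeps-subgraph steps ∘ EraseStep-keeps-subgraph step

claim5 : (j : ℕ) → 2 ≤ j → (n : ℕ) (G : Adj n) → SimpleGraph G →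
    Erasable j G → ¬ HasKConnectedSubgraph (j + 2) G
claim5 j _ n G _ (G′ , erasing , edgeless) (S , H , _ , H⊆G , connected)
  with KConnected⇒edge (subst (λ k → KConnected k H S) (+-comm j 2) connected)
... | x , y , x∈S , y∈S , xy∈H =
  contradiction (trans (sym (H⊆G′ x y x∈S y∈S xy∈H)) (edgeless x y)) λ ()
  where
  H⊆G′ : IsSubgraph G′ S H
  H⊆G′ = Erasing-keeps-subgraph connected erasing H⊆G
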